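{- Let $\mathcal{R}$ be a commutative ring with unity, $k\in\mathbb{N}$, and let $\mathcal{I}_1,\ldots,\mathcal{I}_{2k}$ be mutually co-maximal ideals of $\mathcal{R}$ such that either $\mathcal{I}=\prod_{i=1}^{2k}\mathcal{I}_i$ satisfies the unital set condition (USC) or $\mathcal{I}=\mathcal{R}$. Let $M=[m_{i,j}]_{1\le i,j\le 2k}\in M_{2k\times2k}(\mathcal{R})$ be such that every row is unital, i.e. $\sum_{j=1}^{2k}\langle m_{i,j}\rangle=\mathcal{R}$ for $1\le i\le 2k$. Then there exists $N=[n_{i,j}]\in SP_{2k}(\mathcal{R})$ such that $m_{i,j}\equiv n_{i,j}\bmod\mathcal{I}_i$ for all $1\le i,j\le 2k$.
   Context: $SP_{2k}(\mathcal{R})=\{A\in M_{2k\times2k}(\mathcal{R})\mid A^tJA=J\}$ with $J=\begin{pmatrix}0&I_k\\-I_k&0\end{pmatrix}$. A finite subset of $\mathcal{R}$ is unital if it generates the unit ideal. An ideal $\mathcal{J}\subsetneq\mathcal{R}$ satisfies the USC if for every $n\ge2$ and every unital set $\{a_1,\ldots,a_n\}$ there exists $b\in\langle a_2,\ldots,a_n\rangle$ with $a_1+b$ a unit modulo $\mathcal{J}$. -}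

module Defs where

open import Level using (Level; _⊔_; suc)
open import Data.Nat using (ℕ; _≥_) renaming (_+_ to _+ℕ_; suc to sucℕ; zero to zeroℕ)
open import Data.Fin using (Fin; splitAt; _≟_) renaming (suc to fsuc; zero to fzero)
open import Data.Sum using (_⊎_; inj₁; inj₂)
open import Data.Product using (Σ; ∃; _×_; _,_)
open import Relation.Nullary using (¬_; yes; no)
open import Relation.Binary.PropositionalEquality using (_≡_)
open import Algebra.Bundles using (CommutativeRing)

module _ {c ℓ : Level} (R : CommutativeRing c ℓ) where
  open CommutativeRing R hiding (zero)

  sumR : {n : ℕ} → (Fin n → Carrier) → Carrier
  sumR {zeroℕ} f = 0#
  sumR {sucℕ n} f = f fzero + sumR (λ i → f (fsuc i))

  prodR : {n : ℕ} → (Fin n → Carrier) → Carrier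
  prodR {zeroℕ} f = 1#
  prodR {sucℕ n} f = f fzero * prodR (λ i → f (fsuc i))

  record Ideal (ℓ' : Level) : Set (c ⊔ ℓ ⊔ suc ℓ') where
    field
      _∈I       : Carrier → Set ℓ'
      ∈-resp-≈  : ∀ {x y} → x ≈ y → x ∈I → y ∈I
      0∈        : 0# ∈I
      +-closed  : ∀ {x y} → x ∈I → y ∈I → (x + y) ∈I
      *-closed  : ∀ r {x} → x ∈I → (r * x) ∈I

  open Ideal public using (_∈I)

  InGenerated : ∀ {ℓ'} → (Carrier → Set ℓ') → Carrier → Set (c ⊔ ℓ ⊔ ℓ')
  InGenerated S x = Σ ℕ λ m → Σ (Fin m → Carrier) λ r → Σ (Fin m → Carrier) λ g →
                      ((i : Fin m) → S (g i)) × (x ≈ sumR (λ i → r i * g i))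

  InSpan : {n : ℕ} → (Fin n → Carrier) → Carrier → Set (c ⊔ ℓ)
  InSpan a x = Σ (Fin _ → Carrier) λ r → x ≈ sumR (λ i → r i * a i)

  Unital : {n : ℕ} → (Fin n → Carrier) → Set (c ⊔ ℓ)
  Unital a = InSpan a 1#

  InProduct : ∀ {ℓ'} {n : ℕ} → (Fin n → Ideal ℓ') → Carrier → Set (c ⊔ ℓ ⊔ ℓ')
  InProduct {n = n} I = InGenerated (λ y → Σ (Fin n → Carrier) λ a →
                          ((i : Fin n) → _∈I (I i) (a i)) × (y ≈ prodR a))

  UnitMod : ∀ {ℓ'} → (Carrier → Set ℓ') → Carrier → Set (c ⊔ ℓ')
  UnitMod J a = Σ Carrier λ u → J (a * u - 1#)

  USC : ∀ {ℓ'} → (Carrier → Set ℓ') → Set (c ⊔ ℓ ⊔ ℓ')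
  USC J = (¬ J 1#) ×
          ((m : ℕ) → m ≥ 1 → (a : Fin (sucℕ m) → Carrier) → Unital a →
             Σ Carrier λ b → InSpan (λ i → a (fsuc i)) b × UnitMod J (a fzero + b))

  CoMaximal : ∀ {ℓ'} {n : ℕ} → (Fin n → Ideal ℓ') → Set (c ⊔ ℓ ⊔ ℓ')
  CoMaximal {n = n} I = (i j : Fin n) → ¬ (i ≡ j) →
    Σ Carrier λ x → Σ Carrier λ y → _∈I (I i) x × _∈I (I j) y × (x + y ≈ 1#)

  Mat : ℕ → Set c
  Mat n = Fin n → Fin n → Carrier

  _⊗_ : {n : ℕ} → Mat n → Mat n → Mat n
  (A ⊗ B) i j = sumR (λ l → A i l * B l j)

  transpose : {n : ℕ} → Mat n → Mat n
  transpose A i j = A j i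

  -- the standard symplectic form J = [[0, I_k], [-I_k, 0]] on Fin (k +ℕ k)
  Jmat : (k : ℕ) → Mat (k +ℕ k)
  Jmat k i j with splitAt k i | splitAt k j
  ... | inj₁ p | inj₁ q = 0#
  ... | inj₁ p | inj₂ q with p ≟ q
  ...   | yes _ = 1#
  ...   | no _  = 0#
  Jmat k i j | inj₂ p | inj₁ q with p ≟ q
  ...   | yes _ = - 1#
  ...   | no _  = 0#
  Jmat k i j | inj₂ p | inj₂ q = 0#

  IsSymplectic : (k : ℕ) → Mat (k +ℕ k) → Set ℓ
  IsSymplectic k A = (i j : Fin (k +ℕ k)) → ((transpose A ⊗ Jmat k) ⊗ A) i j ≈ Jmat k i j

{-# OPTIONS --safe #-}
module Submission where

-- Write a row of length 2k as a pair (x , y) of halves. Block shears [[1,S],[0,1]], [[1,0],[S,1]]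
-- with S symmetric and block diagonals diag(U, U⁻ᵀ) are symplectic and act on rows by explicit
-- polynomial formulas in their parameters. For row p = (x , y) of M, the USC yields a combination
-- x₀ + Σ αₗ xₗ₊₁ + Σ βᵣ yᵣ that is a unit modulo Iₚ; a lower shear and a diagonal step make it the
-- first entry, and two more shears then reduce the row to the basis row (0 , e₀) modulo Iₚ.
-- Four shears carry the p-th basis row to (0 , e₀); followed by the inverses of the four
-- reduction steps they carry it to row p of M modulo Iₚ. The shape of these eight steps does not
-- depend on p, so interpolating their parameters over all p by the Chinese remainder theorem
-- gives a single symplectic product N whose p-th row is congruent to row p of M modulo Iₚ.

open import Defs
open import Level using (Level; _⊔_)
open import Data.Empty using (⊥-elim)
open import Data.Fin using (Fin; _↑ˡ_; _↑ʳ_; splitAt; _≟_) renaming (suc to fsuc; zero to fzero)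
open import Data.Fin.Properties using (splitAt-↑ˡ; splitAt-↑ʳ; splitAt⁻¹-↑ˡ; splitAt⁻¹-↑ʳ)
open import Data.List using (List; []; _∷_; _++_)
open import Data.Maybe using (nothing)
open import Data.Nat using (ℕ) renaming (_+_ to _+ℕ_; suc to sucℕ; zero to zeroℕ)
import Data.Nat as ℕ
import Data.Nat.Properties as ℕP
open import Data.Product using (Σ; _×_; _,_; proj₁; proj₂)
open import Data.Sum using (_⊎_; inj₁; inj₂)
open import Data.Unit.Polymorphic using (⊤)
open import Function using (_∘_)
open import Relation.Nullary using (¬_; yes; no)
open import Relation.Binary.Bundles using (Setoid)
open import Relation.Binary.PropositionalEquality as P using (_≡_)
import Relation.Binary.Reasoning.Setoid as SetoidReasoning
open import Algebra.Bundles using (CommutativeRing)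
import Algebra.Properties.Ring as RingProperties
open import Tactic.RingSolver.Core.AlmostCommutativeRing using (fromCommutativeRing)
import Tactic.RingSolver.NonReflective as Solver

-- Defs.sumR is not definitionally the library's Algebra.Definitions.RawMonoid.sum, so the
-- usual summation lemmas are stated for it here.
module FiniteSums {c ℓ : Level} (R : CommutativeRing c ℓ) where
  open CommutativeRing R hiding (zero)
  open RingProperties ring using (-0#≈0#; -‿+-comm)
  open SetoidReasoning setoid

  ∑ : {n : ℕ} → (Fin n → Carrier) → Carrier
  ∑ = sumR R

  ∑-cong : ∀ {n} {f g : Fin n → Carrier} → (∀ i → f i ≈ g i) → ∑ f ≈ ∑ g
  ∑-cong {zeroℕ}  f≈g = refl
  ∑-cong {sucℕ n} f≈g = +-cong (f≈g fzero) (∑-cong (λ i → f≈g (fsuc i)))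

  ∑-zero : ∀ {n} {f : Fin n → Carrier} → (∀ i → f i ≈ 0#) → ∑ f ≈ 0#
  ∑-zero {zeroℕ}  f≈0 = refl
  ∑-zero {sucℕ n} f≈0 = trans (+-cong (f≈0 fzero) (∑-zero (λ i → f≈0 (fsuc i)))) (+-identityˡ 0#)

  ∑-distrib-+ : ∀ {n} (f g : Fin n → Carrier) → ∑ (λ i → f i + g i) ≈ ∑ f + ∑ g
  ∑-distrib-+ {zeroℕ}  f g = sym (+-identityˡ 0#)
  ∑-distrib-+ {sucℕ n} f g = begin
    (f fzero + g fzero) + ∑ (λ i → f (fsuc i) + g (fsuc i))
      ≈⟨ +-congˡ (∑-distrib-+ (λ i → f (fsuc i)) (λ i → g (fsuc i))) ⟩
    (f fzero + g fzero) + (∑ (λ i → f (fsuc i)) + ∑ (λ i → g (fsuc i)))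
      ≈⟨ interchange _ _ _ _ ⟩
    ∑ f + ∑ g ∎
    where
    interchange : ∀ a b x y → (a + b) + (x + y) ≈ (a + x) + (b + y)
    interchange a b x y = begin
      (a + b) + (x + y) ≈⟨ +-assoc a b (x + y) ⟩
      a + (b + (x + y)) ≈⟨ +-congˡ (trans (sym (+-assoc b x y)) (trans (+-congʳ (+-comm b x)) (+-assoc x b y))) ⟩
      a + (x + (b + y)) ≈⟨ sym (+-assoc a x (b + y)) ⟩
      (a + x) + (b + y) ∎

  ∑-neg : ∀ {n} (f : Fin n → Carrier) → ∑ (λ i → - f i) ≈ - ∑ f
  ∑-neg {zeroℕ}  f = sym -0#≈0#
  ∑-neg {sucℕ n} f = trans (+-congˡ (∑-neg (λ i → f (fsuc i)))) (-‿+-comm _ _)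

  *-distribˡ-∑ : ∀ {n} a (f : Fin n → Carrier) → a * ∑ f ≈ ∑ (λ i → a * f i)
  *-distribˡ-∑ {zeroℕ}  a f = zeroʳ a
  *-distribˡ-∑ {sucℕ n} a f = trans (distribˡ a _ _) (+-congˡ (*-distribˡ-∑ a (λ i → f (fsuc i))))

  *-distribʳ-∑ : ∀ {n} a (f : Fin n → Carrier) → ∑ f * a ≈ ∑ (λ i → f i * a)
  *-distribʳ-∑ a f = trans (*-comm _ a) (trans (*-distribˡ-∑ a f) (∑-cong (λ i → *-comm a (f i))))

  ∑-comm : ∀ {m n} (f : Fin m → Fin n → Carrier) → ∑ (λ i → ∑ (f i)) ≈ ∑ (λ j → ∑ (λ i → f i j))
  ∑-comm {zeroℕ} {n} f = sym (∑-zero {n} (λ _ → refl))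
  ∑-comm {sucℕ m} f = trans (+-congˡ (∑-comm (λ i → f (fsuc i))))
                            (sym (∑-distrib-+ (f fzero) (λ j → ∑ (λ i → f (fsuc i) j))))

  ∑-++ : ∀ m n (f : Fin (m +ℕ n) → Carrier) → ∑ f ≈ ∑ (λ i → f (i ↑ˡ n)) + ∑ (λ i → f (m ↑ʳ i))
  ∑-++ zeroℕ    n f = sym (+-identityˡ _)
  ∑-++ (sucℕ m) n f = trans (+-congˡ (∑-++ m n (λ i → f (fsuc i)))) (sym (+-assoc _ _ _))

  δ : ∀ {n} → Fin n → Fin n → Carrier
  δ fzero    fzero    = 1#
  δ fzero    (fsuc j) = 0#
  δ (fsuc i) fzero    = 0#
  δ (fsuc i) (fsuc j) = δ i j

  δ-sym : ∀ {n} (i j : Fin n) → δ i j ≡ δ j i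
  δ-sym fzero    fzero    = P.refl
  δ-sym fzero    (fsuc j) = P.refl
  δ-sym (fsuc i) fzero    = P.refl
  δ-sym (fsuc i) (fsuc j) = δ-sym i j

  δ-diag : ∀ {n} (i : Fin n) → δ i i ≡ 1#
  δ-diag fzero    = P.refl
  δ-diag (fsuc i) = δ-diag i

  δ-off-diag : ∀ {n} {i j : Fin n} → ¬ i ≡ j → δ i j ≡ 0#
  δ-off-diag {i = fzero}  {fzero}  i≢j with () ← i≢j P.refl
  δ-off-diag {i = fzero}  {fsuc j} i≢j = P.refl
  δ-off-diag {i = fsuc i} {fzero}  i≢j = P.refl
  δ-off-diag {i = fsuc i} {fsuc j} i≢j = δ-off-diag (λ i≡j → i≢j (P.cong fsuc i≡j))

  ∑-δˡ : ∀ {n} (i : Fin n) (f : Fin n → Carrier) → ∑ (λ j → δ i j * f j) ≈ f i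
  ∑-δˡ {sucℕ n} fzero f =
    trans (+-cong (*-identityˡ _) (∑-zero (λ j → zeroˡ (f (fsuc j))))) (+-identityʳ _)
  ∑-δˡ {sucℕ n} (fsuc i) f = trans (+-cong (zeroˡ _) (∑-δˡ i (λ j → f (fsuc j)))) (+-identityˡ _)

  ∑-δʳ : ∀ {n} (i : Fin n) (f : Fin n → Carrier) → ∑ (λ j → f j * δ j i) ≈ f i
  ∑-δʳ i f = trans (∑-cong (λ j → trans (*-comm _ _) (*-congʳ (reflexive (δ-sym j i))))) (∑-δˡ i f)

  δ-↑ˡ : ∀ {m} n (i j : Fin m) → δ (i ↑ˡ n) (j ↑ˡ n) ≡ δ i j
  δ-↑ˡ n fzero    fzero    = P.refl
  δ-↑ˡ n fzero    (fsuc j) = P.refl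
  δ-↑ˡ n (fsuc i) fzero    = P.refl
  δ-↑ˡ n (fsuc i) (fsuc j) = δ-↑ˡ n i j

  δ-↑ʳ : ∀ m {n} (i j : Fin n) → δ (m ↑ʳ i) (m ↑ʳ j) ≡ δ i j
  δ-↑ʳ zeroℕ    i j = P.refl
  δ-↑ʳ (sucℕ m) i j = δ-↑ʳ m i j

  δ-↑ˡ-↑ʳ : ∀ m {n} (i : Fin m) (j : Fin n) → δ (i ↑ˡ n) (m ↑ʳ j) ≡ 0#
  δ-↑ˡ-↑ʳ (sucℕ m) fzero    j = P.refl
  δ-↑ˡ-↑ʳ (sucℕ m) (fsuc i) j = δ-↑ˡ-↑ʳ m i j

  δ-↑ʳ-↑ˡ : ∀ m {n} (i : Fin m) (j : Fin n) → δ (m ↑ʳ j) (i ↑ˡ n) ≡ 0#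
  δ-↑ʳ-↑ˡ (sucℕ m) fzero    j = P.refl
  δ-↑ʳ-↑ˡ (sucℕ m) (fsuc i) j = δ-↑ʳ-↑ˡ m i j

module Matrices {c ℓ : Level} (R : CommutativeRing c ℓ) where
  open CommutativeRing R hiding (zero)
  open FiniteSums R

  Vector : ℕ → Set c
  Vector n = Fin n → Carrier

  infixl 7 _·_
  _·_ : ∀ {n} → Vector n → Mat R n → Vector n
  (w · A) j = ∑ (λ l → w l * A l j)

  infixl 6 _+ᵛ_
  _+ᵛ_ : ∀ {n} → Vector n → Vector n → Vector n
  (v +ᵛ w) i = v i + w i

  -ᵛ_ : ∀ {n} → Vector n → Vector n
  (-ᵛ v) i = - v i

  0ᵛ : ∀ {n} → Vector n
  0ᵛ _ = 0#

  infixl 7 _⊙_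
  _⊙_ : ∀ {n} → Mat R n → Mat R n → Mat R n
  _⊙_ = _⊗_ R

  infix 4 _≋_
  _≋_ : ∀ {n} → Mat R n → Mat R n → Set ℓ
  A ≋ B = ∀ i j → A i j ≈ B i j

  ·-cong : ∀ {n} {v w : Vector n} {A B : Mat R n} → (∀ i → v i ≈ w i) → A ≋ B →
           ∀ j → (v · A) j ≈ (w · B) j
  ·-cong v≈w A≋B j = ∑-cong (λ l → *-cong (v≈w l) (A≋B l j))

  ·-⊙ : ∀ {n} (w : Vector n) (A B : Mat R n) j → (w · (A ⊙ B)) j ≈ (w · A · B) j
  ·-⊙ {n} w A B j = begin
    ∑ (λ m → w m * ∑ (λ l → A m l * B l j))     ≈⟨ ∑-cong (λ m → *-distribˡ-∑ (w m) (λ l → A m l * B l j)) ⟩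
    ∑ (λ m → ∑ (λ l → w m * (A m l * B l j)))   ≈⟨ ∑-comm (λ m l → w m * (A m l * B l j)) ⟩
    ∑ (λ l → ∑ (λ m → w m * (A m l * B l j)))   ≈⟨ ∑-cong (λ l → ∑-cong (λ m → sym (*-assoc (w m) (A m l) (B l j)))) ⟩
    ∑ (λ l → ∑ (λ m → (w m * A m l) * B l j))   ≈⟨ ∑-cong (λ l → sym (*-distribʳ-∑ (B l j) (λ m → w m * A m l))) ⟩
    ∑ (λ l → (w · A) l * B l j)                 ∎
    where open SetoidReasoning setoid

  δ-· : ∀ {n} (i : Fin n) (A : Mat R n) j → (δ i · A) j ≈ A i j
  δ-· i A j = ∑-δˡ i (λ l → A l j)

  module _ {n : ℕ} where
    ⊙-assoc : ∀ (A B D : Mat R n) → (A ⊙ B) ⊙ D ≋ A ⊙ (B ⊙ D)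
    ⊙-assoc A B D i j = sym (·-⊙ (A i) B D j)

    ⊙-cong : ∀ {A A′ B B′ : Mat R n} → A ≋ A′ → B ≋ B′ → A ⊙ B ≋ A′ ⊙ B′
    ⊙-cong A≋A′ B≋B′ i = ·-cong (A≋A′ i) B≋B′

    transpose-⊙ : ∀ (A B : Mat R n) → transpose R (A ⊙ B) ≋ transpose R B ⊙ transpose R A
    transpose-⊙ A B i j = ∑-cong (λ l → *-comm (A j l) (B l i))

    ≋-setoid : Setoid c ℓ
    ≋-setoid = record
      { Carrier = Mat R n
      ; _≈_ = _≋_
      ; isEquivalence = record
        { refl = λ i j → refl ; sym = λ A≋B i j → sym (A≋B i j) ; trans = λ A≋B B≋D i j → trans (A≋B i j) (B≋D i j) }
      }

  ⊙-symplectic : ∀ {k} {A B : Mat R (k +ℕ k)} → IsSymplectic R k A → IsSymplectic R k B → IsSymplectic R k (A ⊙ B)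
  ⊙-symplectic {k} {A} {B} A-sympl B-sympl = begin
    [A⊙B]ᵀ ⊙ J ⊙ (A ⊙ B)
      ≈⟨ ⊙-cong (⊙-cong (transpose-⊙ A B) ≋.refl) ≋.refl ⟩
    (Bᵀ ⊙ Aᵀ) ⊙ J ⊙ (A ⊙ B)
      ≈⟨ ⊙-cong (⊙-assoc Bᵀ Aᵀ J) ≋.refl ⟩
    Bᵀ ⊙ (Aᵀ ⊙ J) ⊙ (A ⊙ B)
      ≈⟨ ⊙-assoc Bᵀ (Aᵀ ⊙ J) (A ⊙ B) ⟩
    Bᵀ ⊙ ((Aᵀ ⊙ J) ⊙ (A ⊙ B))
      ≈⟨ ⊙-cong ≋.refl (≋.sym (⊙-assoc (Aᵀ ⊙ J) A B)) ⟩
    Bᵀ ⊙ (Aᵀ ⊙ J ⊙ A ⊙ B)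
      ≈⟨ ⊙-cong ≋.refl (⊙-cong A-sympl ≋.refl) ⟩
    Bᵀ ⊙ (J ⊙ B)
      ≈⟨ ≋.sym (⊙-assoc Bᵀ J B) ⟩
    Bᵀ ⊙ J ⊙ B
      ≈⟨ B-sympl ⟩
    J ∎
    where
    open SetoidReasoning ≋-setoid
    module ≋ = Setoid ≋-setoid
    J Aᵀ Bᵀ [A⊙B]ᵀ : Mat R (k +ℕ k)
    J = Jmat R k
    Aᵀ = transpose R A
    Bᵀ = transpose R B
    [A⊙B]ᵀ = transpose R (A ⊙ B)

module SymplecticBlocks {c ℓ : Level} (R : CommutativeRing c ℓ) (k : ℕ) where
  open CommutativeRing R hiding (zero)
  open RingProperties ring using (-0#≈0#; -‿distribˡ-*; -‿distribʳ-*; ⁻¹-anti-homo‿-)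
  open FiniteSums R
  open Matrices R
  open SetoidReasoning setoid

  ι₁ ι₂ : Fin k → Fin (k +ℕ k)
  ι₁ r = r ↑ˡ k
  ι₂ r = k ↑ʳ r

  data Half : Fin (k +ℕ k) → Set where
    first  : ∀ r → Half (ι₁ r)
    second : ∀ r → Half (ι₂ r)

  half : ∀ i → Half i
  half i with splitAt k i in eq
  ... | inj₁ r = P.subst Half (splitAt⁻¹-↑ˡ eq) (first r)
  ... | inj₂ r = P.subst Half (splitAt⁻¹-↑ʳ eq) (second r)

  Pair : Set c
  Pair = Vector k × Vector k

  halves : Vector (k +ℕ k) → Pair
  halves w = (λ r → w (ι₁ r)) , (λ r → w (ι₂ r))

  infix 4 _≈ᴾ_
  _≈ᴾ_ : Pair → Pair → Set ℓ
  (x , y) ≈ᴾ (x′ , y′) = (∀ r → x r ≈ x′ r) × (∀ r → y r ≈ y′ r)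

  infix 8 _∙_
  _∙_ : Vector k → Vector k → Carrier
  x ∙ y = ∑ (λ s → x s * y s)

  ω : Pair → Pair → Carrier
  ω (x , y) (x′ , y′) = x ∙ y′ - y ∙ x′

  ω-cong : ∀ {u u′ v v′} → u ≈ᴾ u′ → v ≈ᴾ v′ → ω u v ≈ ω u′ v′
  ω-cong (x≈ , y≈) (x′≈ , y′≈) =
    +-cong (∑-cong (λ s → *-cong (x≈ s) (y′≈ s))) (-‿cong (∑-cong (λ s → *-cong (y≈ s) (x′≈ s))))

  column : Mat R (k +ℕ k) → Fin (k +ℕ k) → Pair
  column F j = halves (λ i → F i j)

  J : Mat R (k +ℕ k)
  J = Jmat R k

  module _ (r s : Fin k) where
    J₁₁ : J (ι₁ r) (ι₁ s) ≈ 0#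
    J₁₁ rewrite splitAt-↑ˡ k r k | splitAt-↑ˡ k s k = refl

    J₂₂ : J (ι₂ r) (ι₂ s) ≈ 0#
    J₂₂ rewrite splitAt-↑ʳ k k r | splitAt-↑ʳ k k s = refl

    J₁₂ : J (ι₁ r) (ι₂ s) ≈ δ r s
    J₁₂ rewrite splitAt-↑ˡ k r k | splitAt-↑ʳ k k s with r ≟ s
    ... | yes P.refl = reflexive (P.sym (δ-diag r))
    ... | no r≢s     = reflexive (P.sym (δ-off-diag r≢s))

    J₂₁ : J (ι₂ r) (ι₁ s) ≈ - δ r s
    J₂₁ rewrite splitAt-↑ʳ k k r | splitAt-↑ˡ k s k with r ≟ s
    ... | yes P.refl = -‿cong (reflexive (P.sym (δ-diag r)))
    ... | no r≢s     = trans (sym -0#≈0#) (-‿cong (reflexive (P.sym (δ-off-diag r≢s))))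

  transpose-J-row₁ : (F : Mat R (k +ℕ k)) (i : Fin (k +ℕ k)) (s : Fin k) →
                     (transpose R F ⊙ J) i (ι₁ s) ≈ - F (ι₂ s) i
  transpose-J-row₁ F i s = begin
    ∑ (λ m → F m i * J m (ι₁ s))
      ≈⟨ ∑-++ k k (λ m → F m i * J m (ι₁ s)) ⟩
    ∑ (λ r → F (ι₁ r) i * J (ι₁ r) (ι₁ s)) + ∑ (λ r → F (ι₂ r) i * J (ι₂ r) (ι₁ s))
      ≈⟨ +-cong (∑-zero (λ r → trans (*-congˡ (J₁₁ r s)) (zeroʳ _)))
                (∑-cong (λ r → trans (*-congˡ (J₂₁ r s)) (sym (-‿distribʳ-* _ _)))) ⟩
    0# + ∑ (λ r → - (F (ι₂ r) i * δ r s))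
      ≈⟨ trans (+-identityˡ _) (∑-neg (λ r → F (ι₂ r) i * δ r s)) ⟩
    - ∑ (λ r → F (ι₂ r) i * δ r s)
      ≈⟨ -‿cong (∑-δʳ s (λ r → F (ι₂ r) i)) ⟩
    - F (ι₂ s) i ∎

  transpose-J-row₂ : (F : Mat R (k +ℕ k)) (i : Fin (k +ℕ k)) (s : Fin k) →
                     (transpose R F ⊙ J) i (ι₂ s) ≈ F (ι₁ s) i
  transpose-J-row₂ F i s = begin
    ∑ (λ m → F m i * J m (ι₂ s))
      ≈⟨ ∑-++ k k (λ m → F m i * J m (ι₂ s)) ⟩
    ∑ (λ r → F (ι₁ r) i * J (ι₁ r) (ι₂ s)) + ∑ (λ r → F (ι₂ r) i * J (ι₂ r) (ι₂ s))
      ≈⟨ +-cong (∑-cong (λ r → *-congˡ (J₁₂ r s)))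
                (∑-zero (λ r → trans (*-congˡ (J₂₂ r s)) (zeroʳ _))) ⟩
    ∑ (λ r → F (ι₁ r) i * δ r s) + 0#
      ≈⟨ trans (+-identityʳ _) (∑-δʳ s (λ r → F (ι₁ r) i)) ⟩
    F (ι₁ s) i ∎

  transpose-J-form : (F : Mat R (k +ℕ k)) (i j : Fin (k +ℕ k)) →
                     (transpose R F ⊙ J ⊙ F) i j ≈ ω (column F i) (column F j)
  transpose-J-form F i j = begin
    ∑ (λ l → (transpose R F ⊙ J) i l * F l j)
      ≈⟨ ∑-++ k k (λ l → (transpose R F ⊙ J) i l * F l j) ⟩
    ∑ (λ s → (transpose R F ⊙ J) i (ι₁ s) * F (ι₁ s) j) + ∑ (λ s → (transpose R F ⊙ J) i (ι₂ s) * F (ι₂ s) j)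
      ≈⟨ +-cong (∑-cong (λ s → *-congʳ (transpose-J-row₁ F i s))) (∑-cong (λ s → *-congʳ (transpose-J-row₂ F i s))) ⟩
    ∑ (λ s → - F (ι₂ s) i * F (ι₁ s) j) + ∑ (λ s → F (ι₁ s) i * F (ι₂ s) j)
      ≈⟨ +-congʳ (trans (∑-cong (λ s → sym (-‿distribˡ-* (F (ι₂ s) i) (F (ι₁ s) j)))) (∑-neg (λ s → F (ι₂ s) i * F (ι₁ s) j))) ⟩
    - ∑ (λ s → F (ι₂ s) i * F (ι₁ s) j) + ∑ (λ s → F (ι₁ s) i * F (ι₂ s) j)
      ≈⟨ +-comm _ _ ⟩
    ω (column F i) (column F j) ∎

  symplectic-by-columns : (F : Mat R (k +ℕ k)) → (∀ i j → ω (column F i) (column F j) ≈ J i j) →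
                          IsSymplectic R k F
  symplectic-by-columns F ω≈J i j = trans (transpose-J-form F i j) (ω≈J i j)

  ∙-comm : ∀ x y → x ∙ y ≈ y ∙ x
  ∙-comm x y = ∑-cong (λ s → *-comm (x s) (y s))

  ω-antisym : ∀ u v → ω v u ≈ - ω u v
  ω-antisym (x , y) (x′ , y′) = begin
    x′ ∙ y - y′ ∙ x       ≈⟨ +-cong (∙-comm x′ y) (-‿cong (∙-comm y′ x)) ⟩
    y ∙ x′ - x ∙ y′       ≈⟨ ⁻¹-anti-homo‿- (x ∙ y′) (y ∙ x′) ⟨
    - (x ∙ y′ - y ∙ x′)   ∎

  Block : Set c
  Block = Mat R k

  block : Block → Block → Block → Block → Mat R (k +ℕ k)
  block A B D E i j with splitAt k i | splitAt k j
  ... | inj₁ r | inj₁ s = A r s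
  ... | inj₁ r | inj₂ s = B r s
  ... | inj₂ r | inj₁ s = D r s
  ... | inj₂ r | inj₂ s = E r s

  module _ (A B D E : Block) (r s : Fin k) where
    block₁₁ : block A B D E (ι₁ r) (ι₁ s) ≡ A r s
    block₁₁ rewrite splitAt-↑ˡ k r k | splitAt-↑ˡ k s k = P.refl

    block₁₂ : block A B D E (ι₁ r) (ι₂ s) ≡ B r s
    block₁₂ rewrite splitAt-↑ˡ k r k | splitAt-↑ʳ k k s = P.refl

    block₂₁ : block A B D E (ι₂ r) (ι₁ s) ≡ D r s
    block₂₁ rewrite splitAt-↑ʳ k k r | splitAt-↑ˡ k s k = P.refl

    block₂₂ : block A B D E (ι₂ r) (ι₂ s) ≡ E r s
    block₂₂ rewrite splitAt-↑ʳ k k r | splitAt-↑ʳ k k s = P.refl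

  columns : Block → Block → Fin k → Pair
  columns A D s = (λ r → A r s) , (λ r → D r s)

  record IsSymplecticBlocks (A B D E : Block) : Set ℓ where
    field
      ω₁₁ : ∀ r s → ω (columns A D r) (columns A D s) ≈ 0#
      ω₁₂ : ∀ r s → ω (columns A D r) (columns B E s) ≈ δ r s
      ω₂₂ : ∀ r s → ω (columns B E r) (columns B E s) ≈ 0#

  block-symplectic : ∀ {A B D E} → IsSymplecticBlocks A B D E → IsSymplectic R k (block A B D E)
  block-symplectic {A} {B} {D} {E} blocks = symplectic-by-columns F ω≈J
    where
    open IsSymplecticBlocks blocks
    F : Mat R (k +ℕ k)
    F = block A B D E

    column₁ : ∀ s → column F (ι₁ s) ≈ᴾ columns A D s
    column₁ s = (λ r → reflexive (block₁₁ A B D E r s)) , (λ r → reflexive (block₂₁ A B D E r s))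

    column₂ : ∀ s → column F (ι₂ s) ≈ᴾ columns B E s
    column₂ s = (λ r → reflexive (block₁₂ A B D E r s)) , (λ r → reflexive (block₂₂ A B D E r s))

    ω≈J : ∀ i j → ω (column F i) (column F j) ≈ J i j
    ω≈J i j with half i | half j
    ... | first r  | first s  = trans (ω-cong (column₁ r) (column₁ s)) (trans (ω₁₁ r s) (sym (J₁₁ r s)))
    ... | first r  | second s = trans (ω-cong (column₁ r) (column₂ s)) (trans (ω₁₂ r s) (sym (J₁₂ r s)))
    ... | second r | first s  = trans (ω-cong (column₂ r) (column₁ s))
                                  (trans (ω-antisym (columns A D s) (columns B E r))
                                  (trans (-‿cong (ω₁₂ s r)) (trans (-‿cong (reflexive (δ-sym s r))) (sym (J₂₁ r s)))))
    ... | second r | second s = trans (ω-cong (column₂ r) (column₂ s)) (trans (ω₂₂ r s) (sym (J₂₂ r s)))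

  halves-·-block : ∀ w A B D E → let (x , y) = halves w in
                   halves (w · block A B D E) ≈ᴾ (x · A +ᵛ y · D , x · B +ᵛ y · E)
  halves-·-block w A B D E = (λ c → row (ι₁ c) A D c (λ r → block₁₁ A B D E r c) (λ r → block₂₁ A B D E r c))
                           , (λ c → row (ι₂ c) B E c (λ r → block₁₂ A B D E r c) (λ r → block₂₂ A B D E r c))
    where
    F : Mat R (k +ℕ k)
    F = block A B D E
    x y : Vector k
    x = proj₁ (halves w)
    y = proj₂ (halves w)
    row : ∀ j (U V : Block) c → (∀ r → F (ι₁ r) j ≡ U r c) → (∀ r → F (ι₂ r) j ≡ V r c) →
          (w · F) j ≈ (x · U +ᵛ y · V) c
    row j U V c F₁≡U F₂≡V = trans (∑-++ k k (λ l → w l * F l j))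
      (+-cong (∑-cong (λ r → *-congˡ (reflexive (F₁≡U r)))) (∑-cong (λ r → *-congˡ (reflexive (F₂≡V r)))))

  0ᴹ : Block
  0ᴹ _ _ = 0#

  ·-identity : ∀ (x : Vector k) c → (x · δ) c ≈ x c
  ·-identity x c = ∑-δʳ c x

  ·-zero : ∀ (x : Vector k) c → (x · 0ᴹ) c ≈ 0#
  ·-zero x c = ∑-zero (λ r → zeroʳ (x r))

  δ∙ : ∀ r (x : Vector k) → (λ t → δ t r) ∙ x ≈ x r
  δ∙ r x = trans (∑-cong (λ t → *-congʳ (reflexive (δ-sym t r)))) (∑-δˡ r x)

  ∙δ : ∀ r (x : Vector k) → x ∙ (λ t → δ t r) ≈ x r
  ∙δ r x = ∑-δʳ r x

  0∙ : ∀ (x : Vector k) → 0ᵛ ∙ x ≈ 0#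
  0∙ x = ∑-zero (λ t → zeroˡ (x t))

  ∙0 : ∀ (x : Vector k) → x ∙ 0ᵛ ≈ 0#
  ∙0 x = ∑-zero (λ t → zeroʳ (x t))

  upperShear lowerShear : Block → Mat R (k +ℕ k)
  upperShear S = block δ S 0ᴹ δ
  lowerShear S = block δ 0ᴹ S δ

  blockDiagonal : Block → Block → Mat R (k +ℕ k)
  blockDiagonal A B = block A 0ᴹ 0ᴹ B

  IsSymmetric : Block → Set ℓ
  IsSymmetric S = ∀ r s → S r s ≈ S s r

  upperShear-symplectic : ∀ {S} → IsSymmetric S → IsSymplectic R k (upperShear S)
  upperShear-symplectic {S} S-sym = block-symplectic record
    { ω₁₁ = λ r s → trans (+-cong (∙0 _) (-‿cong (0∙ _))) (-‿inverseʳ 0#)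
    ; ω₁₂ = λ r s → trans (+-cong (δ∙ r (λ t → δ t s)) (-‿cong (0∙ _))) (trans (+-congˡ -0#≈0#) (+-identityʳ _))
    ; ω₂₂ = λ r s → trans (+-cong (∙δ s (λ t → S t r)) (-‿cong (δ∙ r (λ t → S t s)))) (trans (+-congʳ (S-sym s r)) (-‿inverseʳ _))
    }

  lowerShear-symplectic : ∀ {S} → IsSymmetric S → IsSymplectic R k (lowerShear S)
  lowerShear-symplectic {S} S-sym = block-symplectic record
    { ω₁₁ = λ r s → trans (+-cong (δ∙ r (λ t → S t s)) (-‿cong (∙δ s (λ t → S t r)))) (trans (+-congʳ (S-sym r s)) (-‿inverseʳ _))
    ; ω₁₂ = λ r s → trans (+-cong (δ∙ r (λ t → δ t s)) (-‿cong (∙0 _))) (trans (+-congˡ -0#≈0#) (+-identityʳ _))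
    ; ω₂₂ = λ r s → trans (+-cong (0∙ _) (-‿cong (∙0 _))) (-‿inverseʳ 0#)
    }

  blockDiagonal-symplectic : ∀ {A B} → (∀ r s → (λ t → A t r) ∙ (λ t → B t s) ≈ δ r s) →
                             IsSymplectic R k (blockDiagonal A B)
  blockDiagonal-symplectic AᵀB≈I = block-symplectic record
    { ω₁₁ = λ r s → trans (+-cong (∙0 _) (-‿cong (0∙ _))) (-‿inverseʳ 0#)
    ; ω₁₂ = λ r s → trans (+-cong (AᵀB≈I r s) (-‿cong (0∙ _))) (trans (+-congˡ -0#≈0#) (+-identityʳ _))
    ; ω₂₂ = λ r s → trans (+-cong (0∙ _) (-‿cong (∙0 _))) (-‿inverseʳ 0#)
    }

  module _ (w : Vector (k +ℕ k)) where
    private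
      x y : Vector k
      x = proj₁ (halves w)
      y = proj₂ (halves w)

    halves-·-upperShear : ∀ S → halves (w · upperShear S) ≈ᴾ (x , x · S +ᵛ y)
    halves-·-upperShear S = let eq₁ , eq₂ = halves-·-block w δ S 0ᴹ δ in
                      (λ c → trans (eq₁ c) (trans (+-cong (·-identity x c) (·-zero y c)) (+-identityʳ _)))
                    , (λ c → trans (eq₂ c) (+-congˡ (·-identity y c)))

    halves-·-lowerShear : ∀ S → halves (w · lowerShear S) ≈ᴾ (x +ᵛ y · S , y)
    halves-·-lowerShear S = let eq₁ , eq₂ = halves-·-block w δ 0ᴹ S δ in
                      (λ c → trans (eq₁ c) (+-congʳ (·-identity x c)))
                    , (λ c → trans (eq₂ c) (trans (+-cong (·-zero x c) (·-identity y c)) (+-identityˡ _)))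

    halves-·-blockDiagonal : ∀ A B → halves (w · blockDiagonal A B) ≈ᴾ (x · A , y · B)
    halves-·-blockDiagonal A B = let eq₁ , eq₂ = halves-·-block w A 0ᴹ 0ᴹ B in
                      (λ c → trans (eq₁ c) (trans (+-congˡ (·-zero y c)) (+-identityʳ _)))
                    , (λ c → trans (eq₂ c) (trans (+-congʳ (·-zero x c)) (+-identityˡ _)))

  1ᴹ : Mat R (k +ℕ k)
  1ᴹ = blockDiagonal δ δ

  1ᴹ-symplectic : IsSymplectic R k 1ᴹ
  1ᴹ-symplectic = blockDiagonal-symplectic (λ r s → δ∙ r (λ t → δ t s))

  halves-·-1ᴹ : ∀ w → halves (w · 1ᴹ) ≈ᴾ halves w
  halves-·-1ᴹ w = let eq₁ , eq₂ = halves-·-blockDiagonal w δ δ in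
                  (λ c → trans (eq₁ c) (·-identity _ c)) , (λ c → trans (eq₂ c) (·-identity _ c))

  halves-δ₁ : ∀ r → halves (δ (ι₁ r)) ≈ᴾ (δ r , 0ᵛ)
  halves-δ₁ r = (λ s → reflexive (δ-↑ˡ k r s)) , (λ s → reflexive (δ-↑ˡ-↑ʳ k r s))

  halves-δ₂ : ∀ r → halves (δ (ι₂ r)) ≈ᴾ (0ᵛ , δ r)
  halves-δ₂ r = (λ s → reflexive (δ-↑ʳ-↑ˡ k s r)) , (λ s → reflexive (δ-↑ʳ k r s))

module ModuloIdeal {c ℓ ℓ′ : Level} (R : CommutativeRing c ℓ) (I : Ideal R ℓ′) where
  open CommutativeRing R hiding (zero)
  open RingProperties ring using (-0#≈0#; -‿+-comm; -1*x≈-x; ⁻¹-anti-homo‿-; x[y-z]≈xy-xz)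
  open Ideal I using (∈-resp-≈; 0∈; +-closed; *-closed)
  open FiniteSums R
  open Matrices R using (Vector; _·_)
  open SetoidReasoning setoid

  infix 4 _∼_
  _∼_ : Carrier → Carrier → Set ℓ′
  x ∼ y = _∈I I (x - y)

  -‿closed : ∀ {x} → _∈I I x → _∈I I (- x)
  -‿closed {x} x∈I = ∈-resp-≈ (-1*x≈-x x) (*-closed (- 1#) x∈I)

  ≈⇒∼ : ∀ {x y} → x ≈ y → x ∼ y
  ≈⇒∼ {x} {y} x≈y = ∈-resp-≈ (trans (sym (-‿inverseʳ y)) (+-congʳ (sym x≈y))) 0∈

  ∼-refl : ∀ {x} → x ∼ x
  ∼-refl = ≈⇒∼ refl

  ∼-sym : ∀ {x y} → x ∼ y → y ∼ x
  ∼-sym {x} {y} x∼y = ∈-resp-≈ (⁻¹-anti-homo‿- x y) (-‿closed x∼y)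

  ∼-trans : ∀ {x y z} → x ∼ y → y ∼ z → x ∼ z
  ∼-trans {x} {y} {z} x∼y y∼z = ∈-resp-≈ telescope (+-closed x∼y y∼z)
    where
    telescope : (x - y) + (y - z) ≈ x - z
    telescope = begin
      (x - y) + (y - z)   ≈⟨ +-assoc x (- y) (y - z) ⟩
      x + (- y + (y - z)) ≈⟨ +-congˡ (sym (+-assoc (- y) y (- z))) ⟩
      x + ((- y + y) - z) ≈⟨ +-congˡ (trans (+-congʳ (-‿inverseˡ y)) (+-identityˡ (- z))) ⟩
      x - z               ∎

  ∈⇒∼0 : ∀ {x} → _∈I I x → x ∼ 0#
  ∈⇒∼0 {x} x∈I = ∈-resp-≈ (sym (trans (+-congˡ -0#≈0#) (+-identityʳ x))) x∈I

  +-cong∼ : ∀ {a a′ b b′} → a ∼ a′ → b ∼ b′ → a + b ∼ a′ + b′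
  +-cong∼ {a} {a′} {b} {b′} a∼a′ b∼b′ = ∈-resp-≈ regroup (+-closed a∼a′ b∼b′)
    where
    regroup : (a - a′) + (b - b′) ≈ (a + b) - (a′ + b′)
    regroup = begin
      (a - a′) + (b - b′)     ≈⟨ +-assoc a (- a′) (b - b′) ⟩
      a + (- a′ + (b - b′))   ≈⟨ +-congˡ (trans (sym (+-assoc (- a′) b (- b′))) (trans (+-congʳ (+-comm (- a′) b)) (+-assoc b (- a′) (- b′)))) ⟩
      a + (b + (- a′ - b′))   ≈⟨ sym (+-assoc a b _) ⟩
      (a + b) + (- a′ - b′)   ≈⟨ +-congˡ (-‿+-comm a′ b′) ⟩
      (a + b) - (a′ + b′)     ∎

  -‿cong∼ : ∀ {a a′} → a ∼ a′ → - a ∼ - a′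
  -‿cong∼ {a} {a′} a∼a′ = ∈-resp-≈ (sym (-‿+-comm a (- a′))) (-‿closed a∼a′)

  *-congˡ∼ : ∀ a {b b′} → b ∼ b′ → a * b ∼ a * b′
  *-congˡ∼ a {b} {b′} b∼b′ = ∈-resp-≈ (x[y-z]≈xy-xz a b b′) (*-closed a b∼b′)

  *-cong∼ : ∀ {a a′ b b′} → a ∼ a′ → b ∼ b′ → a * b ∼ a′ * b′
  *-cong∼ {a} {a′} {b} {b′} a∼a′ b∼b′ =
    ∼-trans (*-congˡ∼ a b∼b′) (resp (*-comm b′ a) (*-comm b′ a′) (*-congˡ∼ b′ a∼a′))
    where
    resp : ∀ {x x′ y y′} → x ≈ x′ → y ≈ y′ → x ∼ y → x′ ∼ y′
    resp x≈x′ y≈y′ x∼y = ∼-trans (≈⇒∼ (sym x≈x′)) (∼-trans x∼y (≈⇒∼ y≈y′))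

  ∑-cong∼ : ∀ {n} {f g : Fin n → Carrier} → (∀ i → f i ∼ g i) → ∑ f ∼ ∑ g
  ∑-cong∼ {zeroℕ}  f∼g = ∼-refl
  ∑-cong∼ {sucℕ n} f∼g = +-cong∼ (f∼g fzero) (∑-cong∼ (λ i → f∼g (fsuc i)))

  ·-cong∼ : ∀ {n} {v w : Vector n} {A B : Mat R n} → (∀ i → v i ∼ w i) → (∀ i j → A i j ∼ B i j) →
            ∀ j → (v · A) j ∼ (w · B) j
  ·-cong∼ v∼w A∼B j = ∑-cong∼ (λ l → *-cong∼ (v∼w l) (A∼B l j))

  ∑-closed : ∀ {n} (f : Fin n → Carrier) → (∀ i → _∈I I (f i)) → _∈I I (∑ f)
  ∑-closed {zeroℕ}  f f∈I = 0∈
  ∑-closed {sucℕ n} f f∈I = +-closed (f∈I fzero) (∑-closed (λ i → f (fsuc i)) (λ i → f∈I (fsuc i)))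

  prodR-closed : ∀ {n} (f : Fin n → Carrier) q → _∈I I (f q) → _∈I I (prodR R f)
  prodR-closed f fzero    fq∈I = ∈-resp-≈ (*-comm _ _) (*-closed (prodR R (λ i → f (fsuc i))) fq∈I)
  prodR-closed f (fsuc q) fq∈I = *-closed (f fzero) (prodR-closed (λ i → f (fsuc i)) q fq∈I)

  prodR-∼1 : ∀ {n} (f : Fin n → Carrier) → (∀ q → f q ∼ 1#) → prodR R f ∼ 1#
  prodR-∼1 {zeroℕ}  f f∼1 = ∼-refl
  prodR-∼1 {sucℕ n} f f∼1 =
    ∼-trans (*-cong∼ (f∼1 fzero) (prodR-∼1 (λ i → f (fsuc i)) (λ i → f∼1 (fsuc i)))) (≈⇒∼ (*-identityˡ 1#))

module _ {c ℓ ℓ′ : Level} (R : CommutativeRing c ℓ) where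
  open CommutativeRing R hiding (zero)

  InProduct⇒∈ : ∀ {n} (I : Fin n → Ideal R ℓ′) q {z} → InProduct R I z → _∈I (I q) z
  InProduct⇒∈ I q (m , r , g , g∈ , z≈) =
    ∈-resp-≈ (sym z≈) (∑-closed (λ i → r i * g i) (λ i → *-closed (r i) (generator∈ (g∈ i))))
    where
    open Ideal (I q) using (∈-resp-≈; *-closed)
    open ModuloIdeal R (I q) using (∑-closed; prodR-closed)
    generator∈ : ∀ {y} → Σ (Fin _ → Carrier) (λ a → (∀ i → _∈I (I i) (a i)) × (y ≈ prodR R a)) → _∈I (I q) y
    generator∈ (a , a∈ , y≈) = ∈-resp-≈ (sym y≈) (prodR-closed a q (a∈ q))

module ChineseRemainder {c ℓ ℓ′ : Level} (R : CommutativeRing c ℓ) {n : ℕ}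
                        (I : Fin n → Ideal R ℓ′) (comaximal : CoMaximal R I) where
  open CommutativeRing R hiding (zero)
  open FiniteSums R
  module Mod q = ModuloIdeal R (I q)

  infix 4 _∼⟨_⟩_
  _∼⟨_⟩_ : Carrier → Fin n → Carrier → Set ℓ′
  x ∼⟨ q ⟩ y = Mod._∼_ q x y

  separator : Fin n → Fin n → Carrier
  separator p q with p ≟ q
  ... | yes _  = 1#
  ... | no p≢q = proj₁ (proj₂ (comaximal p q p≢q))

  crtBasis : Fin n → Carrier
  crtBasis p = prodR R (separator p)

  crtBasis-∼1 : ∀ p → crtBasis p ∼⟨ p ⟩ 1#
  crtBasis-∼1 p = prodR-∼1 (separator p) separator∼1
    where
    open Mod p
    separator∼1 : ∀ q → separator p q ∼ 1#
    separator∼1 q with p ≟ q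
    ... | yes _ = ∼-refl
    ... | no p≢q with comaximal p q p≢q
    ... | x , y , x∈Iₚ , _ , x+y≈1 =
      ∼-trans (≈⇒∼ (sym (+-identityˡ y))) (∼-trans (+-cong∼ (∼-sym (∈⇒∼0 x∈Iₚ)) ∼-refl) (≈⇒∼ x+y≈1))

  crtBasis-∈ : ∀ {p q} → ¬ p ≡ q → _∈I (I q) (crtBasis p)
  crtBasis-∈ {p} {q} p≢q = Mod.prodR-closed q (separator p) q separator∈
    where
    separator∈ : _∈I (I q) (separator p q)
    separator∈ with p ≟ q
    ... | yes p≡q  = ⊥-elim (p≢q p≡q)
    ... | no p≢q′ = proj₁ (proj₂ (proj₂ (proj₂ (comaximal p q p≢q′))))

  interpolate : (Fin n → Carrier) → Carrier
  interpolate g = ∑ (λ p → crtBasis p * g p)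

  interpolate-∼ : ∀ g q → interpolate g ∼⟨ q ⟩ g q
  interpolate-∼ g q = ∼-trans (∑-cong∼ crtBasis∼δ) (≈⇒∼ (∑-δˡ q g))
    where
    open Mod q
    crtBasis∼δ : ∀ p → crtBasis p * g p ∼ δ q p * g p
    crtBasis∼δ p with p ≟ q
    ... | yes P.refl = *-cong∼ (∼-trans (crtBasis-∼1 p) (≈⇒∼ (reflexive (P.sym (δ-diag p))))) ∼-refl
    ... | no p≢q     = *-cong∼ (∼-trans (∈⇒∼0 (crtBasis-∈ p≢q)) (≈⇒∼ (reflexive (P.sym (δ-off-diag (p≢q ∘ P.sym)))))) ∼-refl

module ElementarySymplectic {c ℓ : Level} (R : CommutativeRing c ℓ) (k′ : ℕ) where
  open CommutativeRing R hiding (zero)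
  open RingProperties ring using (-‿distribʳ-*; \\-leftDividesʳ; //-rightDividesˡ; //-rightDividesʳ)
  open FiniteSums R
  open Matrices R
  open SymplecticBlocks R (sucℕ k′) public
  open SetoidReasoning setoid

  hook : Vector (sucℕ k′) → Block
  hook τ fzero    s        = τ s
  hook τ (fsuc r) fzero    = τ (fsuc r)
  hook τ (fsuc r) (fsuc s) = 0#

  hook-symmetric : ∀ τ → IsSymmetric (hook τ)
  hook-symmetric τ fzero    fzero    = refl
  hook-symmetric τ fzero    (fsuc s) = refl
  hook-symmetric τ (fsuc r) fzero    = refl
  hook-symmetric τ (fsuc r) (fsuc s) = refl

  unipotent : (Fin k′ → Carrier) → Block
  unipotent α fzero    s        = δ fzero s
  unipotent α (fsuc r) fzero    = α r
  unipotent α (fsuc r) (fsuc s) = δ r s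

  unipotent⁻ᵀ : (Fin k′ → Carrier) → Block
  unipotent⁻ᵀ α fzero    fzero    = 1#
  unipotent⁻ᵀ α fzero    (fsuc s) = - α s
  unipotent⁻ᵀ α (fsuc r) s        = δ (fsuc r) s

  unipotent-dual : ∀ α r s → (λ t → unipotent α t r) ∙ (λ t → unipotent⁻ᵀ α t s) ≈ δ r s
  unipotent-dual α fzero    fzero    = trans (+-cong (*-identityˡ 1#) (∑-zero (λ t → zeroʳ (α t)))) (+-identityʳ 1#)
  unipotent-dual α fzero    (fsuc s) = trans (+-cong (*-identityˡ _) (∑-δʳ s α)) (-‿inverseˡ (α s))
  unipotent-dual α (fsuc r) fzero    = trans (+-cong (zeroˡ 1#) (∑-zero (λ t → zeroʳ (δ t r)))) (+-identityˡ 0#)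
  unipotent-dual α (fsuc r) (fsuc s) =
    trans (+-cong (zeroˡ _) (trans (∑-cong (λ t → *-congʳ (reflexive (δ-sym t r)))) (∑-δˡ r (λ t → δ t s)))) (+-identityˡ _)

  e₀ : Vector (sucℕ k′)
  e₀ = δ fzero

  ·-hookₛ : ∀ x τ c → (x · hook τ) (fsuc c) ≈ x fzero * τ (fsuc c)
  ·-hookₛ x τ c = trans (+-congˡ (∑-zero (λ l → zeroʳ (x (fsuc l))))) (+-identityʳ _)

  e₀-·-hook : ∀ τ c → (e₀ · hook τ) c ≈ τ c
  e₀-·-hook τ fzero    = ∑-δˡ fzero τ
  e₀-·-hook τ (fsuc c) = trans (·-hookₛ e₀ τ c) (*-identityˡ _)

  ·-hook-neg : ∀ x τ c → (x · hook (-ᵛ τ)) c ≈ - (x · hook τ) c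
  ·-hook-neg x τ fzero    = trans (∑-cong (λ s → sym (-‿distribʳ-* (x s) (τ s)))) (∑-neg (λ s → x s * τ s))
  ·-hook-neg x τ (fsuc c) =
    trans (·-hookₛ x (-ᵛ τ) c) (trans (sym (-‿distribʳ-* _ _)) (-‿cong (sym (·-hookₛ x τ c))))

  ·-unipotent₀ : ∀ x α → (x · unipotent α) fzero ≈ x fzero + ∑ (λ l → x (fsuc l) * α l)
  ·-unipotent₀ x α = +-congʳ (*-identityʳ _)

  ·-unipotentₛ : ∀ x α c → (x · unipotent α) (fsuc c) ≈ x (fsuc c)
  ·-unipotentₛ x α c = trans (+-cong (zeroʳ _) (∑-δʳ c (λ l → x (fsuc l)))) (+-identityˡ _)

  ·-unipotent⁻ᵀ₀ : ∀ y α → (y · unipotent⁻ᵀ α) fzero ≈ y fzero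
  ·-unipotent⁻ᵀ₀ y α = trans (+-cong (*-identityʳ _) (∑-zero (λ l → zeroʳ (y (fsuc l))))) (+-identityʳ _)

  ·-unipotent⁻ᵀₛ : ∀ y α c → (y · unipotent⁻ᵀ α) (fsuc c) ≈ y fzero * - α c + y (fsuc c)
  ·-unipotent⁻ᵀₛ y α c = +-congˡ (∑-δʳ c (λ l → y (fsuc l)))

  data Kind : Set where
    upper lower diagonal : Kind

  arity : Kind → ℕ
  arity upper    = sucℕ k′
  arity lower    = sucℕ k′
  arity diagonal = k′

  Param : Kind → Set c
  Param κ = Vector (arity κ)

  elementary : ∀ κ → Param κ → Mat R (sucℕ k′ +ℕ sucℕ k′)
  elementary upper    τ = upperShear (hook τ)
  elementary lower    τ = lowerShear (hook τ)
  elementary diagonal α = blockDiagonal (unipotent α) (unipotent⁻ᵀ α)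

  elementary-symplectic : ∀ κ π → IsSymplectic R (sucℕ k′) (elementary κ π)
  elementary-symplectic upper    τ = upperShear-symplectic (hook-symmetric τ)
  elementary-symplectic lower    τ = lowerShear-symplectic (hook-symmetric τ)
  elementary-symplectic diagonal α = blockDiagonal-symplectic (unipotent-dual α)

  act : ∀ κ → Param κ → Pair → Pair
  act upper    τ (x , y) = x , x · hook τ +ᵛ y
  act lower    τ (x , y) = x +ᵛ y · hook τ , y
  act diagonal α (x , y) = x · unipotent α , y · unipotent⁻ᵀ α

  halves-·-elementary : ∀ κ π w → halves (w · elementary κ π) ≈ᴾ act κ π (halves w)
  halves-·-elementary upper    τ w = halves-·-upperShear w (hook τ)
  halves-·-elementary lower    τ w = halves-·-lowerShear w (hook τ)
  halves-·-elementary diagonal α w = halves-·-blockDiagonal w (unipotent α) (unipotent⁻ᵀ α)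

  act-inverse : ∀ κ π u → act κ (-ᵛ π) (act κ π u) ≈ᴾ u
  act-inverse upper τ (x , y) =
    (λ _ → refl) , (λ c → trans (+-congʳ (·-hook-neg x τ c)) (\\-leftDividesʳ _ (y c)))
  act-inverse lower τ (x , y) =
    (λ c → trans (+-congˡ (·-hook-neg y τ c)) (//-rightDividesʳ _ (x c))) , (λ _ → refl)
  act-inverse diagonal α (x , y) = unipotent-inverse , unipotent⁻ᵀ-inverse
    where
    unipotent-inverse : ∀ c → (x · unipotent α · unipotent (-ᵛ α)) c ≈ x c
    unipotent-inverse fzero = begin
      (x · unipotent α · unipotent (-ᵛ α)) fzero
        ≈⟨ ·-unipotent₀ (x · unipotent α) (-ᵛ α) ⟩
      (x · unipotent α) fzero + ∑ (λ l → (x · unipotent α) (fsuc l) * - α l)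
        ≈⟨ +-cong (·-unipotent₀ x α) (∑-cong (λ l → trans (*-congʳ (·-unipotentₛ x α l)) (sym (-‿distribʳ-* _ _)))) ⟩
      x fzero + ∑ (λ l → x (fsuc l) * α l) + ∑ (λ l → - (x (fsuc l) * α l))
        ≈⟨ +-congˡ (∑-neg (λ l → x (fsuc l) * α l)) ⟩
      x fzero + ∑ (λ l → x (fsuc l) * α l) - ∑ (λ l → x (fsuc l) * α l)
        ≈⟨ //-rightDividesʳ _ (x fzero) ⟩
      x fzero ∎
    unipotent-inverse (fsuc c) = trans (·-unipotentₛ (x · unipotent α) (-ᵛ α) c) (·-unipotentₛ x α c)

    unipotent⁻ᵀ-inverse : ∀ c → (y · unipotent⁻ᵀ α · unipotent⁻ᵀ (-ᵛ α)) c ≈ y c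
    unipotent⁻ᵀ-inverse fzero = trans (·-unipotent⁻ᵀ₀ (y · unipotent⁻ᵀ α) (-ᵛ α)) (·-unipotent⁻ᵀ₀ y α)
    unipotent⁻ᵀ-inverse (fsuc c) = begin
      (y · unipotent⁻ᵀ α · unipotent⁻ᵀ (-ᵛ α)) (fsuc c)
        ≈⟨ ·-unipotent⁻ᵀₛ (y · unipotent⁻ᵀ α) (-ᵛ α) c ⟩
      (y · unipotent⁻ᵀ α) fzero * - - α c + (y · unipotent⁻ᵀ α) (fsuc c)
        ≈⟨ +-cong (trans (*-congʳ (·-unipotent⁻ᵀ₀ y α)) (sym (-‿distribʳ-* _ _))) (·-unipotent⁻ᵀₛ y α c) ⟩
      - (y fzero * - α c) + (y fzero * - α c + y (fsuc c))
        ≈⟨ \\-leftDividesʳ _ (y (fsuc c)) ⟩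
      y (fsuc c) ∎

  Schedule : Set
  Schedule = List Kind

  Params : Schedule → Set c
  Params []      = ⊤
  Params (κ ∷ s) = Param κ × Params s

  product : ∀ s → Params s → Mat R (sucℕ k′ +ℕ sucℕ k′)
  product []      _        = 1ᴹ
  product (κ ∷ s) (π , ps) = elementary κ π ⊙ product s ps

  product-symplectic : ∀ s ps → IsSymplectic R (sucℕ k′) (product s ps)
  product-symplectic []      _        = 1ᴹ-symplectic
  product-symplectic (κ ∷ s) (π , ps) =
    ⊙-symplectic {k = sucℕ k′} {elementary κ π} {product s ps} (elementary-symplectic κ π) (product-symplectic s ps)

  run : ∀ s → Params s → Pair → Pair
  run []      _        u = u
  run (κ ∷ s) (π , ps) u = run s ps (act κ π u)

  unrun : ∀ s → Params s → Pair → Pair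
  unrun []      _        u = u
  unrun (κ ∷ s) (π , ps) u = act κ (-ᵛ π) (unrun s ps u)

  infixr 5 _++ᴾ_
  _++ᴾ_ : ∀ {s t} → Params s → Params t → Params (s ++ t)
  _++ᴾ_ {[]}    _        qs = qs
  _++ᴾ_ {κ ∷ s} (π , ps) qs = π , ps ++ᴾ qs

  run-++ : ∀ s {t} ps qs u → run (s ++ t) (ps ++ᴾ qs) u ≡ run t qs (run s ps u)
  run-++ []      _        qs u = P.refl
  run-++ (κ ∷ s) (π , ps) qs u = run-++ s ps qs (act κ π u)

  ·-hook-zero : ∀ x c → (x · hook 0ᵛ) c ≈ 0#
  ·-hook-zero x fzero    = ∑-zero (λ s → zeroʳ (x s))
  ·-hook-zero x (fsuc c) = trans (·-hookₛ x 0ᵛ c) (zeroʳ _)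

  δ-·-hook-δ : ∀ r c → (δ r · hook (δ r)) c ≈ e₀ c
  δ-·-hook-δ r        fzero    = trans (∑-δˡ r (δ r)) (reflexive (δ-diag r))
  δ-·-hook-δ fzero    (fsuc c) = trans (·-hookₛ (δ fzero) (δ fzero) c) (zeroʳ _)
  δ-·-hook-δ (fsuc r) (fsuc c) = trans (·-hookₛ (δ (fsuc r)) (δ (fsuc r)) c) (zeroˡ _)

  act-upper-0ᵛ : ∀ u → act upper 0ᵛ u ≈ᴾ u
  act-upper-0ᵛ (x , y) = (λ _ → refl) , (λ c → trans (+-congʳ (·-hook-zero x c)) (+-identityˡ _))

  act-lower-0ᵛ : ∀ u → act lower 0ᵛ u ≈ᴾ u
  act-lower-0ᵛ (x , y) = (λ c → trans (+-congˡ (·-hook-zero y c)) (+-identityʳ _)) , (λ _ → refl)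

  x-e₀·hook-x : ∀ x c → x c + (e₀ · hook (-ᵛ x)) c ≈ 0#
  x-e₀·hook-x x c = trans (+-congˡ (trans (·-hook-neg e₀ x c) (-‿cong (e₀-·-hook x c)))) (-‿inverseʳ (x c))

  pivot : Pair
  pivot = 0ᵛ , e₀

  toPivot : Schedule
  toPivot = upper ∷ lower ∷ upper ∷ lower ∷ []

  toPivotParams : ∀ {i} → Half i → Params toPivot
  toPivotParams (first r)  = δ r , -ᵛ δ r , 0ᵛ , 0ᵛ , _
  toPivotParams (second r) = 0ᵛ , δ r , e₀ +ᵛ -ᵛ δ r , -ᵛ e₀ , _

  reduceToPivot fromPivot : Schedule
  reduceToPivot = lower ∷ diagonal ∷ upper ∷ lower ∷ []
  fromPivot     = lower ∷ upper ∷ diagonal ∷ lower ∷ []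

  -- run fromPivot (invertParams ps) is definitionally unrun reduceToPivot ps.
  invertParams : Params reduceToPivot → Params fromPivot
  invertParams (τ , α , σ , τ′ , _) = -ᵛ τ′ , -ᵛ σ , -ᵛ α , -ᵛ τ , _

  module Modulo {ℓ′ : Level} (I : Ideal R ℓ′) where
    open ModuloIdeal R I
    open RingProperties ring using (x[y-z]≈xy-xz)
    open Solver (fromCommutativeRing R (λ _ → nothing)) using (solve; _⊜_; _⊕_; ⊝_)

    infix 4 _∼ᵛ_ _∼ᴾ_
    _∼ᵛ_ : ∀ {n} → Vector n → Vector n → Set ℓ′
    v ∼ᵛ w = ∀ i → v i ∼ w i

    _∼ᴾ_ : Pair → Pair → Set ℓ′
    (x , y) ∼ᴾ (x′ , y′) = x ∼ᵛ x′ × y ∼ᵛ y′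

    ≈ᴾ⇒∼ᴾ : ∀ {u v} → u ≈ᴾ v → u ∼ᴾ v
    ≈ᴾ⇒∼ᴾ (x≈ , y≈) = (λ r → ≈⇒∼ (x≈ r)) , (λ r → ≈⇒∼ (y≈ r))

    ∼ᴾ-refl : ∀ {u} → u ∼ᴾ u
    ∼ᴾ-refl = (λ _ → ∼-refl) , (λ _ → ∼-refl)

    ∼ᴾ-sym : ∀ {u v} → u ∼ᴾ v → v ∼ᴾ u
    ∼ᴾ-sym (x∼ , y∼) = (λ r → ∼-sym (x∼ r)) , (λ r → ∼-sym (y∼ r))

    ∼ᴾ-trans : ∀ {u v w} → u ∼ᴾ v → v ∼ᴾ w → u ∼ᴾ w
    ∼ᴾ-trans (x∼ , y∼) (x∼′ , y∼′) = (λ r → ∼-trans (x∼ r) (x∼′ r)) , (λ r → ∼-trans (y∼ r) (y∼′ r))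

    halves-∼ᴾ⇒∼ᵛ : ∀ {v w} → halves v ∼ᴾ halves w → v ∼ᵛ w
    halves-∼ᴾ⇒∼ᵛ (x∼ , y∼) j with half j
    ... | first r  = x∼ r
    ... | second r = y∼ r

    hook-cong∼ : ∀ {τ τ′} → τ ∼ᵛ τ′ → ∀ r s → hook τ r s ∼ hook τ′ r s
    hook-cong∼ τ∼τ′ fzero    s        = τ∼τ′ s
    hook-cong∼ τ∼τ′ (fsuc r) fzero    = τ∼τ′ (fsuc r)
    hook-cong∼ τ∼τ′ (fsuc r) (fsuc s) = ∼-refl

    unipotent-cong∼ : ∀ {α α′} → α ∼ᵛ α′ → ∀ r s → unipotent α r s ∼ unipotent α′ r s
    unipotent-cong∼ α∼α′ fzero    s        = ∼-refl
    unipotent-cong∼ α∼α′ (fsuc r) fzero    = α∼α′ r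
    unipotent-cong∼ α∼α′ (fsuc r) (fsuc s) = ∼-refl

    unipotent⁻ᵀ-cong∼ : ∀ {α α′} → α ∼ᵛ α′ → ∀ r s → unipotent⁻ᵀ α r s ∼ unipotent⁻ᵀ α′ r s
    unipotent⁻ᵀ-cong∼ α∼α′ fzero    fzero    = ∼-refl
    unipotent⁻ᵀ-cong∼ α∼α′ fzero    (fsuc s) = -‿cong∼ (α∼α′ s)
    unipotent⁻ᵀ-cong∼ α∼α′ (fsuc r) s        = ∼-refl

    act-cong : ∀ κ {π π′ u u′} → π ∼ᵛ π′ → u ∼ᴾ u′ → act κ π u ∼ᴾ act κ π′ u′
    act-cong upper    τ∼ (x∼ , y∼) = x∼ , (λ c → +-cong∼ (·-cong∼ x∼ (hook-cong∼ τ∼) c) (y∼ c))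
    act-cong lower    τ∼ (x∼ , y∼) = (λ c → +-cong∼ (x∼ c) (·-cong∼ y∼ (hook-cong∼ τ∼) c)) , y∼
    act-cong diagonal α∼ (x∼ , y∼) = ·-cong∼ x∼ (unipotent-cong∼ α∼) , ·-cong∼ y∼ (unipotent⁻ᵀ-cong∼ α∼)

    infix 4 _∼ˢ_
    _∼ˢ_ : ∀ {s} → Params s → Params s → Set ℓ′
    _∼ˢ_ {[]}    _        _          = ⊤
    _∼ˢ_ {κ ∷ s} (π , ps) (π′ , ps′) = π ∼ᵛ π′ × ps ∼ˢ ps′

    run-cong : ∀ s ps {u u′} → u ∼ᴾ u′ → run s ps u ∼ᴾ run s ps u′
    run-cong []      _        u∼u′ = u∼u′
    run-cong (κ ∷ s) (π , ps) u∼u′ = run-cong s ps (act-cong κ (λ _ → ∼-refl) u∼u′)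

    unrun-run : ∀ s ps {u v} → run s ps u ∼ᴾ v → unrun s ps v ∼ᴾ u
    unrun-run []      _        run∼v = ∼ᴾ-sym run∼v
    unrun-run (κ ∷ s) (π , ps) {u} run∼v =
      ∼ᴾ-trans (act-cong κ (λ _ → ∼-refl) (unrun-run s ps run∼v)) (≈ᴾ⇒∼ᴾ (act-inverse κ π u))

    halves-·-product : ∀ s {ps ps′} w {u} → ps ∼ˢ ps′ → halves w ∼ᴾ u → halves (w · product s ps) ∼ᴾ run s ps′ u
    halves-·-product [] w _ w∼u = ∼ᴾ-trans (≈ᴾ⇒∼ᴾ (halves-·-1ᴹ w)) w∼u
    halves-·-product (κ ∷ s) {π , ps} {π′ , ps′} w (π∼π′ , ps∼ps′) w∼u =
      ∼ᴾ-trans (≈ᴾ⇒∼ᴾ (split-⊙ ι₁ , split-⊙ ι₂))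
        (halves-·-product s (w · elementary κ π) ps∼ps′
          (∼ᴾ-trans (≈ᴾ⇒∼ᴾ (halves-·-elementary κ π w)) (act-cong κ π∼π′ w∼u)))
      where
      split-⊙ : ∀ (ι : Fin (sucℕ k′) → Fin (sucℕ k′ +ℕ sucℕ k′)) r →
                (w · (elementary κ π ⊙ product s ps)) (ι r) ≈ (w · elementary κ π · product s ps) (ι r)
      split-⊙ ι r = ·-⊙ w (elementary κ π) (product s ps) (ι r)

    act-step : ∀ κ π {u v w} → u ∼ᴾ v → act κ π v ≈ᴾ w → act κ π u ∼ᴾ w
    act-step κ π u∼v act≈w = ∼ᴾ-trans (act-cong κ (λ _ → ∼-refl) u∼v) (≈ᴾ⇒∼ᴾ act≈w)

    run-toPivot : ∀ i → run toPivot (toPivotParams (half i)) (halves (δ i)) ∼ᴾ pivot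
    run-toPivot i with half i
    ... | first r =
      act-step lower 0ᵛ (act-step upper 0ᵛ (act-step lower (-ᵛ δ r)
        (act-step upper (δ r) (≈ᴾ⇒∼ᴾ (halves-δ₁ r))
          ((λ _ → refl) , (λ c → trans (+-identityʳ _) (δ-·-hook-δ r c))))
        (x-e₀·hook-x (δ r) , (λ _ → refl)))
        (act-upper-0ᵛ pivot)) (act-lower-0ᵛ pivot)
    ... | second r =
      act-step lower (-ᵛ e₀) (act-step upper (e₀ +ᵛ -ᵛ δ r) (act-step lower (δ r)
        (act-step upper 0ᵛ (≈ᴾ⇒∼ᴾ (halves-δ₂ r)) (act-upper-0ᵛ (0ᵛ , δ r)))
        ((λ c → trans (+-identityˡ _) (δ-·-hook-δ r c)) , (λ _ → refl)))
        ((λ _ → refl) , (λ c → trans (+-congʳ (e₀-·-hook (e₀ +ᵛ -ᵛ δ r) c)) (//-rightDividesˡ (δ r c) (e₀ c)))))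
        (x-e₀·hook-x e₀ , (λ _ → refl))

    record UnitCombination (x y : Vector (sucℕ k′)) : Set (c ⊔ ℓ′) where
      field
        α    : Vector k′
        β    : Vector (sucℕ k′)
        u    : Carrier
        unit : (x fzero + (∑ (λ l → α l * x (fsuc l)) + β ∙ y)) * u ∼ 1#

    module RowReduction {x y : Vector (sucℕ k′)} (combination : UnitCombination x y) where
      open UnitCombination combination

      S : Carrier
      S = ∑ (λ l → α l * β (fsuc l))

      -- The correction - S cancels the cross term y₀ Σ αₗ βₗ₊₁ produced by the diagonal step,
      -- so that x₂ fzero is exactly the unit combination.
      τ : Vector (sucℕ k′)
      τ fzero    = β fzero - S
      τ (fsuc l) = β (fsuc l)

      x₁ : Vector (sucℕ k′)
      x₁ = proj₁ (act lower τ (x , y))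

      u₂ : Pair
      u₂ = act diagonal α (act lower τ (x , y))

      x₂ y₂ : Vector (sucℕ k′)
      x₂ = proj₁ u₂
      y₂ = proj₂ u₂

      y∙τ+correction : y ∙ τ + y fzero * S ≈ β ∙ y
      y∙τ+correction = begin
        (y fzero * (β fzero - S) + Q) + y fzero * S
          ≈⟨ +-congʳ (+-congʳ (x[y-z]≈xy-xz (y fzero) (β fzero) S)) ⟩
        ((y fzero * β fzero - y fzero * S) + Q) + y fzero * S
          ≈⟨ solve 4 (λ a n q b → (((a ⊕ n) ⊕ q) ⊕ b) ⊜ ((a ⊕ q) ⊕ (n ⊕ b))) refl
                     (y fzero * β fzero) (- (y fzero * S)) Q (y fzero * S) ⟩
        (y fzero * β fzero + Q) + (- (y fzero * S) + y fzero * S)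
          ≈⟨ trans (+-congˡ (-‿inverseˡ _)) (+-identityʳ _) ⟩
        y ∙ β
          ≈⟨ ∙-comm y β ⟩
        β ∙ y ∎
        where
        Q : Carrier
        Q = ∑ (λ l → y (fsuc l) * β (fsuc l))

      tail-correction : ∑ (λ l → x₁ (fsuc l) * α l) ≈ ∑ (λ l → α l * x (fsuc l)) + y fzero * S
      tail-correction = begin
        ∑ (λ l → (x (fsuc l) + (y · hook τ) (fsuc l)) * α l)
          ≈⟨ ∑-cong (λ l → trans (distribʳ (α l) _ _) (+-cong (*-comm _ _) (*-congʳ (·-hookₛ y τ l)))) ⟩
        ∑ (λ l → α l * x (fsuc l) + y fzero * β (fsuc l) * α l)
          ≈⟨ ∑-distrib-+ (λ l → α l * x (fsuc l)) (λ l → y fzero * β (fsuc l) * α l) ⟩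
        ∑ (λ l → α l * x (fsuc l)) + ∑ (λ l → y fzero * β (fsuc l) * α l)
          ≈⟨ +-congˡ (trans (∑-cong (λ l → trans (*-assoc (y fzero) (β (fsuc l)) (α l)) (*-congˡ (*-comm (β (fsuc l)) (α l)))))
                            (sym (*-distribˡ-∑ (y fzero) (λ l → α l * β (fsuc l))))) ⟩
        ∑ (λ l → α l * x (fsuc l)) + y fzero * S ∎

      x₂₀≈unit : x₂ fzero ≈ x fzero + (∑ (λ l → α l * x (fsuc l)) + β ∙ y)
      x₂₀≈unit = begin
        x₂ fzero
          ≈⟨ ·-unipotent₀ x₁ α ⟩
        (x fzero + y ∙ τ) + ∑ (λ l → x₁ (fsuc l) * α l)
          ≈⟨ +-congˡ tail-correction ⟩
        (x fzero + y ∙ τ) + (∑ (λ l → α l * x (fsuc l)) + y fzero * S)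
          ≈⟨ solve 4 (λ a b c d → ((a ⊕ b) ⊕ (c ⊕ d)) ⊜ (a ⊕ (c ⊕ (b ⊕ d)))) refl (x fzero) (y ∙ τ) _ (y fzero * S) ⟩
        x fzero + (∑ (λ l → α l * x (fsuc l)) + (y ∙ τ + y fzero * S))
          ≈⟨ +-congˡ (+-congˡ y∙τ+correction) ⟩
        x fzero + (∑ (λ l → α l * x (fsuc l)) + β ∙ y) ∎

      x₂₀-invertible : ∀ t → x₂ fzero * (u * t) ∼ t
      x₂₀-invertible t = ∼-trans (≈⇒∼ (sym (*-assoc _ u t)))
        (∼-trans (*-cong∼ (∼-trans (≈⇒∼ (*-congʳ x₂₀≈unit)) unit) (∼-refl {t})) (≈⇒∼ (*-identityˡ t)))

      σ₊ : Vector k′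
      σ₊ c = - (u * y₂ (fsuc c))

      E : Carrier
      E = ∑ (λ l → x₂ (fsuc l) * σ₊ l)

      -- Chosen so that the upper shear by σ turns y₂ into e₀, dividing by the unit x₂ fzero.
      σ : Vector (sucℕ k′)
      σ fzero    = u * (1# - (y₂ fzero + E))
      σ (fsuc c) = σ₊ c

      y₃ : Vector (sucℕ k′)
      y₃ = proj₂ (act upper σ u₂)

      y₃∼e₀ : y₃ ∼ᵛ e₀
      y₃∼e₀ fzero = ∼-trans (+-cong∼ (+-cong∼ (x₂₀-invertible _) (∼-refl {E})) (∼-refl {y₂ fzero}))
        (≈⇒∼ (begin
          ((1# - (y₂ fzero + E)) + E) + y₂ fzero
            ≈⟨ solve 4 (λ o n e a → (((o ⊕ n) ⊕ e) ⊕ a) ⊜ (o ⊕ (n ⊕ (a ⊕ e)))) refl 1# (- (y₂ fzero + E)) E (y₂ fzero) ⟩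
          1# + (- (y₂ fzero + E) + (y₂ fzero + E))
            ≈⟨ trans (+-congˡ (-‿inverseˡ _)) (+-identityʳ 1#) ⟩
          1# ∎))
      y₃∼e₀ (fsuc c) = ∼-trans (≈⇒∼ (+-congʳ (trans (·-hookₛ x₂ σ c) (sym (-‿distribʳ-* _ _)))))
        (∼-trans (+-cong∼ (-‿cong∼ (x₂₀-invertible (y₂ (fsuc c)))) ∼-refl) (≈⇒∼ (-‿inverseˡ _)))

      reduceParams : Params reduceToPivot
      reduceParams = τ , α , σ , -ᵛ x₂ , _

      run-reduce : run reduceToPivot reduceParams (x , y) ∼ᴾ pivot
      run-reduce = act-step lower (-ᵛ x₂) ((λ _ → ∼-refl) , y₃∼e₀) (x-e₀·hook-x x₂ , (λ _ → refl))

  module Interpolation {ℓ′ : Level} {n : ℕ} (I : Fin n → Ideal R ℓ′) (comaximal : CoMaximal R I) where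
    open ChineseRemainder R I comaximal

    interpolateParams : ∀ s → (Fin n → Params s) → Params s
    interpolateParams []      _  = _
    interpolateParams (κ ∷ s) πs = (λ i → interpolate (λ p → proj₁ (πs p) i)) , interpolateParams s (proj₂ ∘ πs)

    interpolateParams-∼ : ∀ s πs q → Modulo._∼ˢ_ (I q) (interpolateParams s πs) (πs q)
    interpolateParams-∼ []      _  _ = _
    interpolateParams-∼ (κ ∷ s) πs q =
      (λ i → interpolate-∼ (λ p → proj₁ (πs p) i) q) , interpolateParams-∼ s (proj₂ ∘ πs) q

module SymplecticLift {c ℓ ℓ′ : Level} (R : CommutativeRing c ℓ) (k′ : ℕ)
                    (I : Fin (sucℕ k′ +ℕ sucℕ k′) → Ideal R ℓ′) (comaximal : CoMaximal R I)
                    (usc : USC R (InProduct R I))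
                    (M : Mat R (sucℕ k′ +ℕ sucℕ k′)) (unital : ∀ i → Unital R (M i)) where
  open CommutativeRing R hiding (zero)
  open FiniteSums R
  open Matrices R
  open ElementarySymplectic R k′
  open Interpolation I comaximal

  schedule : Schedule
  schedule = toPivot ++ fromPivot

  module _ (p : Fin (sucℕ k′ +ℕ sucℕ k′)) where
    open Modulo (I p)
    open ModuloIdeal R (I p)

    x y : Vector (sucℕ k′)
    x = proj₁ (halves (M p))
    y = proj₂ (halves (M p))

    unitCombination : UnitCombination x y
    unitCombination with proj₂ usc (k′ +ℕ sucℕ k′) (ℕP.m≤n⇒m≤o+n k′ (ℕ.s≤s ℕ.z≤n)) (M p) (unital p)
    ... | b , (ρ , b≈) , (u , unit) = record
      { α    = λ l → ρ (l ↑ˡ sucℕ k′)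
      ; β    = λ r → ρ (k′ ↑ʳ r)
      ; u    = u
      ; unit = ∼-trans (≈⇒∼ (*-congʳ (+-congˡ (sym (trans b≈ (∑-++ k′ (sucℕ k′) _)))))) (InProduct⇒∈ R I p unit)
      }

    open RowReduction unitCombination

    rowParams : Params schedule
    rowParams = _++ᴾ_ {toPivot} {fromPivot} (toPivotParams (half p)) (invertParams reduceParams)

    run-rowParams : run schedule rowParams (halves (δ p)) ∼ᴾ halves (M p)
    run-rowParams rewrite run-++ toPivot {fromPivot} (toPivotParams (half p)) (invertParams reduceParams) (halves (δ p)) =
      ∼ᴾ-trans (run-cong fromPivot (invertParams reduceParams) (run-toPivot p))
               (unrun-run reduceToPivot reduceParams run-reduce)

  params : Params schedule
  params = interpolateParams schedule rowParams

  N : Mat R (sucℕ k′ +ℕ sucℕ k′)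
  N = product schedule params

  N-symplectic : IsSymplectic R (sucℕ k′) N
  N-symplectic = product-symplectic schedule params

  N-row : ∀ q → Modulo._∼ᴾ_ (I q) (halves (N q)) (halves (M q))
  N-row q = ∼ᴾ-trans (≈ᴾ⇒∼ᴾ N-row-as-δ·N) (∼ᴾ-trans
    (halves-·-product schedule {params} {rowParams q} (δ q) (interpolateParams-∼ schedule rowParams q) ∼ᴾ-refl)
    (run-rowParams q))
    where
    open Modulo (I q)
    N-row-as-δ·N : halves (N q) ≈ᴾ halves (δ q · N)
    N-row-as-δ·N = (λ r → sym (δ-· q N (ι₁ r))) , (λ r → sym (δ-· q N (ι₂ r)))

  M-N∈I : ∀ i j → _∈I (I i) (M i j - N i j)
  M-N∈I q j = ModuloIdeal.∼-sym R (I q) (Modulo.halves-∼ᴾ⇒∼ᵛ (I q) {N q} {M q} (N-row q) j)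

open import Data.Nat using (_+_)

mainTheorem6 : {c ℓ ℓ' : Level} (R : CommutativeRing c ℓ) (k : ℕ)
    (I : Fin (k + k) → Ideal R ℓ') →
    CoMaximal R I →
    (USC R (InProduct R I) ⊎ ((x : CommutativeRing.Carrier R) → InProduct R I x)) →
    (M : Mat R (k + k)) →
    ((i : Fin (k + k)) → Unital R (M i)) →
    Σ (Mat R (k + k)) λ N → IsSymplectic R k N ×
      ((i j : Fin (k + k)) → _∈I (I i) (CommutativeRing._-_ R (M i j) (N i j)))
mainTheorem6 R k I _ (inj₂ everything∈I) M _ =
  1ᴹ , 1ᴹ-symplectic , λ i j → InProduct⇒∈ R I i (everything∈I _)
  where open SymplecticBlocks R k
mainTheorem6 R zeroℕ I _ (inj₁ _) M _ = (λ ()) , (λ ()) , (λ ())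
mainTheorem6 R (sucℕ k′) I comaximal (inj₁ usc) M unital = N , N-symplectic , M-N∈I
  where open SymplecticLift R k′ I comaximal usc M unital
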